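{- Let $G=(V,E)$ be a directed acyclic graph with source $s$ and destination $t$, $s\neq t$, in which every vertex and every edge lies on some directed $s$-$t$ path, and let $T\subseteq V$. Then $T$ is a tracking set for $G$ if and only if for every two distinct vertices $u,v\in T\cup\{s,t\}$ there is at most one directed path from $u$ to $v$ in the subgraph of $G$ induced by $V\setminus (T\setminus\{u,v\})$.
   Context: A tracking set for $G$ is a set $T\subseteq V$ such that for any two distinct directed $s$-$t$ paths $P_1,P_2$ in $G$, $T\cap V(P_1)\ne T\cap V(P_2)$. -}

module Defs where

open import Data.Nat using (ℕ)
open import Data.Fin using (Fin)
open import Data.Bool using (Bool; true; false)
open import Data.List using (List; []; _∷_; _++_)
open import Data.List.Relation.Unary.All using (All)
open import Data.List.Relation.Unary.Unique.Propositional using (Unique)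
import Data.List.Membership.Propositional as LM
open import Data.Fin.Subset using (Subset; _∈_; _∉_)
open import Data.Product using (Σ; ∃; _×_)
open import Data.Sum using (_⊎_)
open import Relation.Binary.PropositionalEquality using (_≡_; _≢_)
open import Relation.Nullary using (¬_)
open import Function.Bundles using (_⇔_)

Graph : ℕ → Set
Graph n = Fin n → Fin n → Bool

module _ {n : ℕ} (E : Graph n) where

  data Walk : Fin n → Fin n → List (Fin n) → Set where
    here : ∀ {u} → Walk u u (u ∷ [])
    step : ∀ {u w v xs} → E u w ≡ true → Walk w v xs → Walk u v (u ∷ xs)

  -- A directed path: a walk with no repeated vertex (identified with its
  -- vertex sequence, which determines it in a simple digraph).
  IsPath : Fin n → Fin n → List (Fin n) → Set
  IsPath u v xs = Walk u v xs × Unique xs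

  IsPathIn : (Fin n → Set) → Fin n → Fin n → List (Fin n) → Set
  IsPathIn W u v xs = IsPath u v xs × All W xs

  Acyclic : Set
  Acyclic = ∀ u w xs → E u w ≡ true → ¬ Walk w u xs

  EdgeOn : Fin n → Fin n → List (Fin n) → Set
  EdgeOn u v xs = Σ (List (Fin n)) λ as → Σ (List (Fin n)) λ bs →
                    xs ≡ as ++ (u ∷ v ∷ bs)

  record STGraph (s t : Fin n) : Set where
    field
      s≢t         : s ≢ t
      acyclic     : Acyclic
      source      : ∀ u → E u s ≡ false
      destination : ∀ u → E t u ≡ false
      vertexOnPath : ∀ v → ∃ λ P → IsPath s t P × v LM.∈ P
      edgeOnPath  : ∀ u v → E u v ≡ true → ∃ λ P → IsPath s t P × EdgeOn u v P

  SameTrace : Subset n → List (Fin n) → List (Fin n) → Set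
  SameTrace T P₁ P₂ = ∀ x → ((x ∈ T × x LM.∈ P₁) ⇔ (x ∈ T × x LM.∈ P₂))

  TrackingSet : Fin n → Fin n → Subset n → Set
  TrackingSet s t T = ∀ P₁ P₂ → IsPath s t P₁ → IsPath s t P₂ → P₁ ≢ P₂ →
                      ¬ SameTrace T P₁ P₂

  InTst : Fin n → Fin n → Subset n → Fin n → Set
  InTst s t T x = x ∈ T ⊎ (x ≡ s ⊎ x ≡ t)

  Allowed : Subset n → Fin n → Fin n → Fin n → Set
  Allowed T u v x = x ∉ T ⊎ (x ≡ u ⊎ x ≡ v)

  LocalUniqueness : Fin n → Fin n → Subset n → Set
  LocalUniqueness s t T = ∀ u v → InTst s t T u → InTst s t T v → u ≢ v →
    ∀ P₁ P₂ → IsPathIn (Allowed T u v) u v P₁ → IsPathIn (Allowed T u v) u v P₂ →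
    P₁ ≡ P₂

-- Two distinct u-v paths avoiding T ∖ {u,v} extend, through an s-u path and a v-t path, to
-- distinct s-t paths with the same trace on T: the only T-vertices they can differ in are u and
-- v, which both contain.
-- Conversely, let P₁, P₂ be s-t paths with equal traces. From a common vertex u of T ∪ {s,t},
-- let k₁ and k₂ be the next vertices of T ∪ {s,t} on P₁ and P₂. Equal traces put k₂ on P₁ after
-- u, hence at or after k₁, and symmetrically, so acyclicity forces k₁ = k₂; the two segments
-- u…k₁ avoid T ∖ {u,k₁}, so they coincide by local uniqueness.
module Submission where

open import Defs
open import Data.Nat using (ℕ; suc; _≤_; s≤s)
open import Data.Nat.Properties using (≤-refl; ≤-trans)
open import Data.Fin using (Fin; _≟_)
open import Data.Fin.Subset using (Subset; _∈_)
open import Data.Fin.Subset.Properties using (_∈?_)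
open import Data.Bool using (true)
open import Data.List using (List; []; _∷_; _++_; [_]; drop; length)
open import Data.List.Properties using (++-cancelˡ; ++-cancelʳ; ≡-dec; length-++-≤ʳ; ∷-injectiveʳ)
open import Data.List.Relation.Unary.All as All using (All; []; _∷_)
open import Data.List.Relation.Unary.All.Properties using (¬Any⇒All¬; ++⁺)
open import Data.List.Relation.Unary.Any using (here; there)
open import Data.List.Relation.Unary.Unique.Propositional using (Unique)
open import Data.List.Relation.Unary.AllPairs using ([]; _∷_)
open import Data.List.Membership.Propositional using () renaming (_∈_ to _∈ₗ_)
open import Data.List.Membership.Propositional.Properties using (∈-++⁺ˡ; ∈-++⁺ʳ; ∈-++⁻)
open import Data.Product using (∃; _×_; _,_; proj₁; proj₂)
open import Data.Sum using (_⊎_; inj₁; inj₂; map₂)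
open import Data.Empty using (⊥-elim)
open import Relation.Binary.PropositionalEquality using (_≡_; _≢_; refl; sym; trans; cong)
open import Relation.Nullary using (¬_; Dec; yes; no)
open import Relation.Nullary.Decidable using (_⊎-dec_)
open import Relation.Unary using (∁)
open import Function.Bundles using (_⇔_; mk⇔; Equivalence)

infixl 5 _⊕_

-- Vertex sequences of two walks glued at the shared end vertex.
_⊕_ : ∀ {a} {A : Set a} → List A → List A → List A
xs ⊕ ys = xs ++ drop 1 ys

∈-drop1 : ∀ {a} {A : Set a} {x : A} ys → x ∈ₗ drop 1 ys → x ∈ₗ ys
∈-drop1 (_ ∷ _) x∈ = there x∈

∈-⊕⁻ : ∀ {a} {A : Set a} {x : A} xs {ys} → x ∈ₗ xs ⊕ ys → x ∈ₗ xs ⊎ x ∈ₗ ys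
∈-⊕⁻ xs {ys} x∈ = map₂ (∈-drop1 ys) (∈-++⁻ xs x∈)

module Walks {n : ℕ} (E : Graph n) where

  V : Set
  V = Fin n

  infix 4 _⇝_ _⇝⁺_

  _⇝_ : V → V → Set
  a ⇝ b = ∃ λ xs → Walk E a b xs

  _⇝⁺_ : V → V → Set
  a ⇝⁺ b = ∃ λ w → E a w ≡ true × w ⇝ b

  ⊕-walk : ∀ {a b c xs ys} → Walk E a b xs → Walk E b c ys → Walk E a c (xs ⊕ ys)
  ⊕-walk here here          = here
  ⊕-walk here (step e W)    = step e W
  ⊕-walk (step e W₁) W₂     = step e (⊕-walk W₁ W₂)

  ⇝-trans : ∀ {a b c} → a ⇝ b → b ⇝ c → a ⇝ c
  ⇝-trans (_ , W₁) (_ , W₂) = _ , ⊕-walk W₁ W₂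

  ⇝⁺-⇝-trans : ∀ {a b c} → a ⇝⁺ b → b ⇝ c → a ⇝⁺ c
  ⇝⁺-⇝-trans (w , e , a⇝b) b⇝c = w , e , ⇝-trans a⇝b b⇝c

  walk-head : ∀ {a b xs} → Walk E a b xs → xs ≡ a ∷ drop 1 xs
  walk-head here       = refl
  walk-head (step _ _) = refl

  walk-≡ : ∀ {a b c xs ys} → Walk E a b xs → Walk E a c ys → drop 1 xs ≡ drop 1 ys → xs ≡ ys
  walk-≡ W₁ W₂ eq = trans (walk-head W₁) (trans (cong (_ ∷_) eq) (sym (walk-head W₂)))

  first∈walk : ∀ {a b xs} → Walk E a b xs → a ∈ₗ xs
  first∈walk here       = here refl
  first∈walk (step _ _) = here refl

  last∈walk : ∀ {a b xs} → Walk E a b xs → b ∈ₗ xs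
  last∈walk here       = here refl
  last∈walk (step _ W) = there (last∈walk W)

  walk-split : ∀ {a b x xs} → Walk E a b xs → x ∈ₗ xs → a ⇝ x × x ⇝ b
  walk-split here       (here refl) = (_ , here) , (_ , here)
  walk-split (step e W) (here refl) = (_ , here) , (_ , step e W)
  walk-split (step e W) (there x∈) with walk-split W x∈
  ... | (_ , W₁) , x⇝b = (_ , step e W₁) , x⇝b

  ∈-⊕⁺ʳ : ∀ {a b x xs ys} → Walk E a b ys → a ∈ₗ xs → x ∈ₗ ys → x ∈ₗ xs ⊕ ys
  ∈-⊕⁺ʳ W a∈xs x∈ys with walk-head W
  ∈-⊕⁺ʳ W a∈xs (here refl)  | refl = ∈-++⁺ˡ a∈xs
  ∈-⊕⁺ʳ {xs = xs} W a∈xs (there x∈) | refl = ∈-++⁺ʳ xs x∈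

  ⇝⁺-has-in-edge : ∀ {a b} → a ⇝⁺ b → ∃ λ y → E y b ≡ true
  ⇝⁺-has-in-edge (_ , e , _ , W) = last-edge e W
    where
      last-edge : ∀ {a w b xs} → E a w ≡ true → Walk E w b xs → ∃ λ y → E y b ≡ true
      last-edge e here         = _ , e
      last-edge _ (step e' W)  = last-edge e' W

  module FirstHit {P : V → Set} (P? : ∀ x → Dec (P x)) where

    record Hit (w b : V) (ws : List V) : Set where
      constructor hit
      field
        before  : List V
        key     : V
        after   : List V
        ws≡     : ws ≡ before ++ key ∷ after
        missed  : All (∁ P) before
        key-P   : P key
        prefix  : Walk E w key (before ++ [ key ])
        suffix  : Walk E key b (key ∷ after)

    firstHit : ∀ {w b ws} → P b → Walk E w b ws → Hit w b ws
    firstHit Pb here = hit [] _ [] refl [] Pb here here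
    firstHit {w} Pb (step e W) with P? w
    ... | yes Pw = hit [] w _ refl [] Pw here (step e W)
    ... | no ¬Pw with firstHit Pb W
    ...   | hit A k B refl missed Pk pre suf = hit (w ∷ A) k B refl (¬Pw ∷ missed) Pk (step e pre) suf

  module _ (acyclic : Acyclic E) where

    ⇝⁺-⇝-asym : ∀ {a b} → a ⇝⁺ b → ¬ b ⇝ a
    ⇝⁺-⇝-asym (w , e , _ , W₁) (_ , W₂) = acyclic _ w _ e (⊕-walk W₁ W₂)

    ⇝⁺-irrefl : ∀ {a} → ¬ a ⇝⁺ a
    ⇝⁺-irrefl a⇝⁺a = ⇝⁺-⇝-asym a⇝⁺a (_ , here)

    ⇝-antisym : ∀ {a b} → a ⇝ b → b ⇝ a → a ≡ b
    ⇝-antisym (_ , here)       _   = refl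
    ⇝-antisym (_ , step e W)   b⇝a = ⊥-elim (⇝⁺-⇝-asym (_ , e , _ , W) b⇝a)

    walk-unique : ∀ {a b xs} → Walk E a b xs → Unique xs
    walk-unique here       = [] ∷ []
    walk-unique (step e W) =
      ¬Any⇒All¬ _ (λ a∈ → ⇝⁺-⇝-asym (_ , e , proj₁ (walk-split W a∈)) (_ , here)) ∷ walk-unique W

    walk⇒path : ∀ {a b xs} → Walk E a b xs → IsPath E a b xs
    walk⇒path W = W , walk-unique W

    ∈-after-first : ∀ {P : V → Set} {u x k A B} → u ⇝⁺ x → P x → All (∁ P) A →
                    x ∈ₗ u ∷ A ++ k ∷ B → x ∈ₗ k ∷ B
    ∈-after-first u⇝⁺x _  _  (here refl) = ⊥-elim (⇝⁺-irrefl u⇝⁺x)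
    ∈-after-first {A = A} _ Px missed (there x∈) with ∈-++⁻ A x∈
    ... | inj₁ x∈A  = ⊥-elim (All.lookup missed x∈A Px)
    ... | inj₂ x∈kB = x∈kB

module Tracking {n : ℕ} (E : Graph n) (s t : Fin n) (G : STGraph E s t) (T : Subset n) where
  open STGraph G
  open Walks E

  Trace⊆ : List V → List V → Set
  Trace⊆ xs ys = ∀ x → x ∈ T → x ∈ₗ xs → x ∈ₗ ys

  sameTrace⇒⊆ : ∀ {xs ys} → SameTrace E T xs ys → Trace⊆ xs ys × Trace⊆ ys xs
  sameTrace⇒⊆ same = (λ x x∈T x∈ → proj₂ (Equivalence.to (same x) (x∈T , x∈)))
                   , (λ x x∈T x∈ → proj₂ (Equivalence.from (same x) (x∈T , x∈)))

  ⊆⇒sameTrace : ∀ {xs ys} → Trace⊆ xs ys → Trace⊆ ys xs → SameTrace E T xs ys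
  ⊆⇒sameTrace ⊆₁ ⊆₂ x = mk⇔ (λ (x∈T , x∈) → x∈T , ⊆₁ x x∈T x∈) (λ (x∈T , x∈) → x∈T , ⊆₂ x x∈T x∈)

  on-st-path : ∀ v → s ⇝ v × v ⇝ t
  on-st-path v with vertexOnPath v
  ... | _ , (W , _) , v∈ = walk-split W v∈

  detour-⊆ : ∀ {u v pre P P' suf} → Walk E s u pre → Walk E u v P → Walk E u v P' → Walk E v t suf →
             All (Allowed E T u v) P → Trace⊆ (pre ⊕ P ⊕ suf) (pre ⊕ P' ⊕ suf)
  detour-⊆ {pre = pre} {P} {P'} Wpre W W' Wsuf allowed x x∈T x∈ with ∈-⊕⁻ (pre ⊕ P) x∈
  ... | inj₂ x∈suf = ∈-⊕⁺ʳ Wsuf (∈-⊕⁺ʳ W' (last∈walk Wpre) (last∈walk W')) x∈suf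
  ... | inj₁ x∈ with ∈-⊕⁻ pre x∈
  ...   | inj₁ x∈pre = ∈-++⁺ˡ (∈-++⁺ˡ x∈pre)
  ...   | inj₂ x∈P = ∈-++⁺ˡ (∈-⊕⁺ʳ W' (last∈walk Wpre) x∈P')
    where
      x∈P' : x ∈ₗ P'
      x∈P' with All.lookup allowed x∈P
      ... | inj₁ x∉T        = ⊥-elim (x∉T x∈T)
      ... | inj₂ (inj₁ refl) = first∈walk W'
      ... | inj₂ (inj₂ refl) = last∈walk W'

  tracking⇒locallyUnique : TrackingSet E s t T → LocalUniqueness E s t T
  tracking⇒locallyUnique tracking u v _ _ _ P₁ P₂ ((W₁ , _) , allowed₁) ((W₂ , _) , allowed₂)
    with ≡-dec _≟_ P₁ P₂ | on-st-path u | on-st-path v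
  ... | yes P₁≡P₂ | _ | _ = P₁≡P₂
  ... | no P₁≢P₂ | (pre , Wpre) , _ | _ , (suf , Wsuf) =
    ⊥-elim (tracking _ _ (walk⇒path acyclic (detour W₁)) (walk⇒path acyclic (detour W₂)) detours-differ
                     (⊆⇒sameTrace (detour-⊆ Wpre W₁ W₂ Wsuf allowed₁) (detour-⊆ Wpre W₂ W₁ Wsuf allowed₂)))
    where
      detour : ∀ {P} → Walk E u v P → Walk E s t (pre ⊕ P ⊕ suf)
      detour W = ⊕-walk (⊕-walk Wpre W) Wsuf

      detours-differ : pre ⊕ P₁ ⊕ suf ≢ pre ⊕ P₂ ⊕ suf
      detours-differ eq = P₁≢P₂ (walk-≡ W₁ W₂ (++-cancelˡ pre _ _ (++-cancelʳ (drop 1 suf) _ _ eq)))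

  t-has-no-out-edge : ∀ {w} → E t w ≢ true
  t-has-no-out-edge {w} e with trans (sym e) (destination w)
  ... | ()

  s-has-no-in-edge : ∀ {y} → E y s ≢ true
  s-has-no-in-edge {y} e with trans (sym e) (source y)
  ... | ()

  Key : V → Set
  Key = InTst E s t T

  Key? : ∀ x → Dec (Key x)
  Key? x = x ∈? T ⊎-dec x ≟ s ⊎-dec x ≟ t

  open FirstHit Key?

  later-key∈ : ∀ {u k k' A B ys} → u ⇝⁺ k' → Key k' → k' ∈ₗ ys → Trace⊆ ys (u ∷ A ++ k ∷ B) →
                Walk E k t (k ∷ B) → k' ∈ₗ u ∷ A ++ k ∷ B
  later-key∈ _ (inj₁ k'∈T) k'∈ys ⊆ _ = ⊆ _ k'∈T k'∈ys
  later-key∈ u⇝⁺s (inj₂ (inj₁ refl)) _ _ _ = ⊥-elim (s-has-no-in-edge (proj₂ (⇝⁺-has-in-edge u⇝⁺s)))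
  later-key∈ {A = A} _ (inj₂ (inj₂ refl)) _ _ suf = there (∈-++⁺ʳ A (last∈walk suf))

  next-key-⇝ : ∀ {u k k' A B ys} → u ⇝⁺ k' → Key k' → k' ∈ₗ ys → Trace⊆ ys (u ∷ A ++ k ∷ B) →
               All (∁ Key) A → Walk E k t (k ∷ B) → k ⇝ k'
  next-key-⇝ u⇝⁺k' k'-key k'∈ys ⊆ missed suf =
    proj₁ (walk-split suf (∈-after-first acyclic u⇝⁺k' k'-key missed (later-key∈ u⇝⁺k' k'-key k'∈ys ⊆ suf)))

  tail-⊆ : ∀ {u k A B B'} → u ⇝⁺ k → All (∁ Key) A → Walk E k t (k ∷ B) →
           Trace⊆ (u ∷ A ++ k ∷ B) (u ∷ A ++ k ∷ B') → Trace⊆ (k ∷ B) (k ∷ B')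
  tail-⊆ {A = A} u⇝⁺k missed suf ⊆ x x∈T x∈kB =
    ∈-after-first acyclic (⇝⁺-⇝-trans u⇝⁺k (proj₁ (walk-split suf x∈kB))) (inj₁ x∈T) missed
                  (⊆ x x∈T (there (∈-++⁺ʳ A x∈kB)))

  leg-end∈ : ∀ {u k : V} A {B} → k ∈ₗ u ∷ A ++ k ∷ B
  leg-end∈ A = there (∈-++⁺ʳ A (here refl))

  leg-allowed : ∀ {u k A} → All (∁ Key) A → All (Allowed E T u k) (u ∷ A ++ [ k ])
  leg-allowed missed =
    inj₂ (inj₁ refl) ∷ ++⁺ (All.map (λ ¬key → inj₁ (λ x∈T → ¬key (inj₁ x∈T))) missed) (inj₂ (inj₂ refl) ∷ [])

  module _ (unique : LocalUniqueness E s t T) where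

    trace-injective-from : ∀ fuel {u xs ys} → length xs ≤ fuel → Key u →
                           Walk E u t xs → Walk E u t ys → Trace⊆ xs ys → Trace⊆ ys xs → xs ≡ ys
    trace-injective-from _ _ _ here here _ _ = refl
    trace-injective-from _ _ _ here (step e _) _ _ = ⊥-elim (t-has-no-out-edge e)
    trace-injective-from _ _ _ (step e _) here _ _ = ⊥-elim (t-has-no-out-edge e)
    trace-injective-from (suc fuel) {u} (s≤s len) u-key (step e₁ W₁) (step e₂ W₂) ⊆₁ ⊆₂
      with firstHit (inj₂ (inj₂ refl)) W₁ | firstHit (inj₂ (inj₂ refl)) W₂
    ... | hit A₁ k₁ B₁ refl missed₁ k₁-key pre₁ suf₁ | hit A₂ k₂ B₂ refl missed₂ k₂-key pre₂ suf₂
      with ⇝-antisym acyclic (next-key-⇝ (_ , e₂ , _ , pre₂) k₂-key (leg-end∈ A₂) ⊆₂ missed₁ suf₁)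
                             (next-key-⇝ (_ , e₁ , _ , pre₁) k₁-key (leg-end∈ A₁) ⊆₁ missed₂ suf₂)
    ... | refl
      with unique u k₁ u-key k₁-key (λ { refl → ⇝⁺-irrefl acyclic (_ , e₁ , _ , pre₁) }) _ _
                  (walk⇒path acyclic (step e₁ pre₁) , leg-allowed missed₁)
                  (walk⇒path acyclic (step e₂ pre₂) , leg-allowed missed₂)
    ... | same-leg with ++-cancelʳ [ k₁ ] A₁ A₂ (∷-injectiveʳ same-leg)
    ... | refl = cong (λ rest → u ∷ A₁ ++ rest)
                      (trace-injective-from fuel (≤-trans (length-++-≤ʳ (k₁ ∷ B₁) {A₁}) len) k₁-key suf₁ suf₂
                         (tail-⊆ (_ , e₁ , _ , pre₁) missed₁ suf₁ ⊆₁)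
                         (tail-⊆ (_ , e₁ , _ , pre₁) missed₁ suf₂ ⊆₂))

    locallyUnique⇒tracking : TrackingSet E s t T
    locallyUnique⇒tracking P₁ P₂ (W₁ , _) (W₂ , _) P₁≢P₂ same with sameTrace⇒⊆ same
    ... | ⊆₁ , ⊆₂ = P₁≢P₂ (trace-injective-from (length P₁) ≤-refl (inj₂ (inj₁ refl)) W₁ W₂ ⊆₁ ⊆₂)

lemma16 : ∀ {n} (E : Graph n) (s t : Fin n) → STGraph E s t → (T : Subset n) →
          TrackingSet E s t T ⇔ LocalUniqueness E s t T
lemma16 E s t G T = mk⇔ tracking⇒locallyUnique locallyUnique⇒tracking
  where open Tracking E s t G T
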